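{- There exists a constant $c_1 > 0$ such that $$s(n) \geq \frac{n^2}{2^{(c_1+o(1))\sqrt{\log_2 n}}},$$ where $o(1)$ denotes a quantity tending to $0$ as $n \to \infty$.
   Context: A skew corner is a configuration of points of the form $(x,y),(x,y+d),(x+d,y')$ with $x,y,y',d \in \mathbb{Z}$; it is non-trivial if $d \neq 0$. A subset of $\mathbb{Z}^2$ is skew corner-free if it contains no non-trivial skew corner. For a positive integer $n$, $[n]=\{1,\dots,n\}$ and $s(n)$ denotes the largest size of a skew corner-free subset of $[n]^2$. -}

module Defs where

open import Data.Nat as ℕ using (ℕ; _^_)
open import Data.Integer as ℤ using (ℤ; +_)
open import Data.Product using (Σ; _×_; _,_)
open import Data.List using (List; length)
open import Data.List.Membership.Propositional using (_∈_)
open import Data.List.Relation.Unary.All using (All)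
open import Data.List.Relation.Unary.Unique.Propositional using (Unique)
open import Relation.Binary.PropositionalEquality using (_≢_)
open import Data.Empty using (⊥)

InGrid : ℕ → ℤ × ℤ → Set
InGrid n (x , y) = (+ 1 ℤ.≤ x × x ℤ.≤ + n) × (+ 1 ℤ.≤ y × y ℤ.≤ + n)

SkewCornerFree : List (ℤ × ℤ) → Set
SkewCornerFree A =
  ∀ (x y y′ d : ℤ) → d ≢ + 0 →
  (x , y) ∈ A → (x , y ℤ.+ d) ∈ A → (x ℤ.+ d , y′) ∈ A → ⊥

-- A skew corner-free subset of [n]² of size m (so s(n) ≥ m iff such exists).
SkewCornerFreeSubsetOfSize : ℕ → ℕ → Set
SkewCornerFreeSubsetOfSize n m =
  Σ (List (ℤ × ℤ)) λ A →
    Unique A × All (InGrid n) A × SkewCornerFree A × length A ≡ m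
  where open import Relation.Binary.PropositionalEquality using (_≡_)

-- Exact encoding, for naturals n ≥ 1 and k, l ≥ 1, of the real inequality
--     m ≥ n² / 2^{(k/l)·√(log₂ n)} ,
-- i.e.  log₂(n²/m) ≤ (k/l)·√(log₂ n).
-- This holds iff every rational p = a/b ≥ 0 with p < log₂(n²/m)
-- (i.e. 2^a · m^b < n^(2b)) satisfies p ≤ (k/l)√(log₂ n)
-- (i.e. a²l² ≤ k²b² log₂ n, i.e. 2^(a²l²) ≤ n^(k²b²)).
BoundHolds : (k l n m : ℕ) → Set
BoundHolds k l n m =
  ∀ (a b : ℕ) → 1 ℕ.≤ b →
  2 ^ a ℕ.* m ^ b ℕ.< n ^ (2 ℕ.* b) →
  2 ^ (a ℕ.* a ℕ.* (l ℕ.* l)) ℕ.≤ n ^ (k ℕ.* k ℕ.* (b ℕ.* b))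

sLowerBound : (k l n : ℕ) → Set
sLowerBound k l n = Σ ℕ λ m → SkewCornerFreeSubsetOfSize n m × BoundHolds k l n m

-- Behrend-type construction.  A pair (X, Y) of vectors in {0,…,h-1}ᵏ is placed at the
-- point (1 + ⟦X⟧, 1 + ⟦Y⟧) of [n]², where ⟦_⟧ reads a vector as a base-2h numeral, so
-- that sums of two coordinates are computed digitwise without carries.  A skew corner
-- (X, Y₁), (X, Y₂), (X′, Y′) then forces X′ + Y₁ = X + Y₂, whence
--   ‖X′‖² + 2⟨X, Y₁⟩ = ‖X‖² + 2⟨X, Y₂⟩ + ‖Y₁ − Y₂‖².
-- On a level set of (‖X‖², ⟨X, Y⟩) this gives Y₁ = Y₂, i.e. d = 0.  There are fewer than
-- M² = (1 + k h²)² level sets, so one of them has at least h²ᵏ / M² points.  Taking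
-- h = 2ʲ, k = j + 1 and 2^(k²) ≤ n < 2^((k+1)²) gives n² / m ≤ 2^(12k) ≤ 2^(12 √log₂ n)
-- for every n ≥ 2, i.e. the theorem with c₁ = 12 and no need for the o(1) term.
module Submission where

open import Defs
open import Function using (_∘_)
open import Level using (0ℓ)
open import Data.Bool using (true; false)
open import Data.Nat using (ℕ; zero; suc; _+_; _*_; _^_; _≤_; _<_; _⊔_; _≟_; ∣_-_∣; z≤n; s≤s; s≤s⁻¹; NonZero; >-nonZero)
open import Data.Nat.Properties
open import Data.Nat.DivMod using (_%_; m<n⇒m%n≡m; [m+kn]%n≡m%n)
open import Data.Nat.Tactic.RingSolver using (solve-∀)
open import Algebra.Properties.CommutativeSemigroup +-commutativeSemigroup using (x∙yz≈xz∙y) renaming (interchange to +-interchange)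
open import Algebra.Properties.CommutativeSemigroup *-commutativeSemigroup using () renaming (interchange to *-interchange)
open import Data.Integer as ℤ using (ℤ; +_)
import Data.Integer.Properties as ℤ
open import Algebra.Properties.AbelianGroup ℤ.+-0-abelianGroup using (identityʳ-unique)
open import Data.Fin using (Fin; toℕ)
open import Data.Fin.Properties using (toℕ<n; toℕ-injective)
open import Data.Product using (Σ; ∃-syntax; _×_; _,_; proj₁; proj₂)
open import Data.Sum using (inj₁; inj₂; reduce)
open import Data.Vec as Vec using (Vec; []; _∷_; zipWith; sum)
open import Data.Vec.Properties using (∷-injective)
open import Data.Vec.Relation.Unary.All as VecAll using ([]; _∷_)
import Data.Vec.Relation.Unary.All.Properties as VecAll
open import Data.List as List using (List; [_]; length; filter; allFin; cartesianProduct; cartesianProductWith)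
open import Data.List.Properties using (length-++; length-map; length-tabulate)
open import Data.List.Relation.Unary.All as All using (All)
import Data.List.Relation.Unary.All.Properties as All
open import Data.List.Relation.Unary.AllPairs using ([]; _∷_)
open import Data.List.Relation.Unary.Unique.Propositional using (Unique)
import Data.List.Relation.Unary.Unique.Propositional.Properties as Unique
open import Data.List.Relation.Binary.Sublist.Propositional.Properties using (filter-⊆; filter⁺; length-mono-≤)
open import Data.List.Membership.Propositional using (_∈_)
open import Data.List.Membership.Propositional.Properties using (∈-map⁻; ∈-filter⁻)
open import Relation.Nullary using (contradiction)
open import Relation.Nullary.Decidable using (does)
open import Relation.Unary using (Pred; Decidable)
open import Relation.Unary.Properties using (∁?)
open import Relation.Binary.PropositionalEquality using (_≡_; refl; sym; trans; cong; cong₂; subst; module ≡-Reasoning)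

remainder-quotient-unique : ∀ {q r r′ s s′} → r < q → r′ < q →
                            r + s * q ≡ r′ + s′ * q → r ≡ r′ × s ≡ s′
remainder-quotient-unique {q} {r} {r′} {s} {s′} r<q r′<q eq = r≡r′ , s≡s′
  where
  instance
    q≢0 : NonZero q
    q≢0 = >-nonZero (≤-<-trans z≤n r<q)
  open ≡-Reasoning
  r≡r′ : r ≡ r′
  r≡r′ = begin
    r                 ≡⟨ m<n⇒m%n≡m r<q ⟨
    r % q             ≡⟨ [m+kn]%n≡m%n r s q ⟨
    (r + s * q) % q   ≡⟨ cong (_% q) eq ⟩
    (r′ + s′ * q) % q ≡⟨ [m+kn]%n≡m%n r′ s′ q ⟩
    r′ % q            ≡⟨ m<n⇒m%n≡m r′<q ⟩
    r′                ∎
  s≡s′ : s ≡ s′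
  s≡s′ = *-cancelʳ-≡ s s′ q (+-cancelˡ-≡ r _ _ (trans eq (cong (_+ s′ * q) (sym r≡r′))))

-- The expansion of (a + (c − b))², arranged so that no subtraction occurs.
square-shift : ∀ {a′ a b c} → a′ + b ≡ a + c →
               a′ * a′ + 2 * (a * b) ≡ a * a + 2 * (a * c) + ∣ b - c ∣ * ∣ b - c ∣
square-shift {a′} {a} {b} {c} eq with ≤-total b c
... | inj₁ b≤c
  with δ , refl ← m≤n⇒∃[o]m+o≡n b≤c
  with refl ← +-cancelʳ-≡ b a′ (a + δ) (trans eq (x∙yz≈xz∙y a b δ))
  rewrite ∣m-m+n∣≡n b δ
  = expand a b δ
  where
  expand : ∀ a b δ → (a + δ) * (a + δ) + 2 * (a * b) ≡ a * a + 2 * (a * (b + δ)) + δ * δ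
  expand = solve-∀
... | inj₂ c≤b
  with δ , refl ← m≤n⇒∃[o]m+o≡n c≤b
  with refl ← +-cancelʳ-≡ c a (a′ + δ) (trans (sym eq) (x∙yz≈xz∙y a′ c δ))
  rewrite ∣-∣-comm (c + δ) c | ∣m-m+n∣≡n c δ
  = expand a′ c δ
  where
  expand : ∀ a c δ → a * a + 2 * ((a + δ) * (c + δ)) ≡ (a + δ) * (a + δ) + 2 * ((a + δ) * c) + δ * δ
  expand = solve-∀

n<2^n : ∀ n → n < 2 ^ n
n<2^n zero    = s≤s z≤n
n<2^n (suc n) = ≤-trans (+-mono-≤ (m^n>0 2 n) (n<2^n n)) (≤-reflexive (cong (λ t → 2 ^ n + t) (sym (+-identityʳ (2 ^ n)))))

^-distribʳ-* : ∀ m n o → (m * n) ^ o ≡ m ^ o * n ^ o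
^-distribʳ-* m n zero    = refl
^-distribʳ-* m n (suc o) = trans (cong (m * n *_) (^-distribʳ-* m n o)) (*-interchange m n (m ^ o) (n ^ o))

1+k[2^j]²≤2^[k+2j] : ∀ k j → suc (k * (2 ^ j * 2 ^ j)) ≤ 2 ^ (k + (j + j))
1+k[2^j]²≤2^[k+2j] k j = begin
  suc (k * (2 ^ j * 2 ^ j)) ≡⟨ cong (λ t → suc (k * t)) (^-distribˡ-+-* 2 j j) ⟨
  suc (k * 2 ^ (j + j))     ≤⟨ +-monoˡ-≤ (k * 2 ^ (j + j)) (m^n>0 2 (j + j)) ⟩
  suc k * 2 ^ (j + j)       ≤⟨ *-monoˡ-≤ (2 ^ (j + j)) (n<2^n k) ⟩
  2 ^ k * 2 ^ (j + j)       ≡⟨ ^-distribˡ-+-* 2 k (j + j) ⟨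
  2 ^ (k + (j + j))         ∎
  where open ≤-Reasoning

*-mono-≤-2^ : ∀ {x y} a b → x ≤ 2 ^ a → y ≤ 2 ^ b → x * y ≤ 2 ^ (a + b)
*-mono-≤-2^ a b x≤ y≤ = ≤-trans (*-mono-≤ x≤ y≤) (≤-reflexive (sym (^-distribˡ-+-* 2 a b)))

bracket : (g : ℕ → ℕ) → (∀ i → g i < g (suc i)) → ∀ {n} → g 0 ≤ n → ∃[ i ] g i ≤ n × n < g (suc i)
bracket g g↑ {zero}  g₀≤0 = 0 , g₀≤0 , ≤-<-trans z≤n (g↑ 0)
bracket g g↑ {suc n} g₀≤1+n with m≤n⇒m<n∨m≡n g₀≤1+n
... | inj₂ g₀≡1+n = 0 , ≤-reflexive g₀≡1+n , subst (_< g 1) g₀≡1+n (g↑ 0)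
... | inj₁ g₀<1+n with i , gᵢ≤n , n<gᵢ₊₁ ← bracket g g↑ (s≤s⁻¹ g₀<1+n) with m≤n⇒m<n∨m≡n n<gᵢ₊₁
...   | inj₁ 1+n<gᵢ₊₁ = i , m≤n⇒m≤1+n gᵢ≤n , 1+n<gᵢ₊₁
...   | inj₂ 1+n≡gᵢ₊₁ = suc i , ≤-reflexive (sym 1+n≡gᵢ₊₁) , subst (_< g (suc (suc i))) (sym 1+n≡gᵢ₊₁) (g↑ (suc i))

2^i²<2^[1+i]² : ∀ i → 2 ^ (i * i) < 2 ^ (suc i * suc i)
2^i²<2^[1+i]² i = ^-monoʳ-< 2 (s≤s (s≤s z≤n)) (*-mono-< (n<1+n i) (n<1+n i))

skew-corner-sum : ∀ {a a′ b b′ d} → + suc a ℤ.+ d ≡ + suc a′ → + suc b ℤ.+ d ≡ + suc b′ → a′ + b ≡ a + b′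
skew-corner-sum {a} {a′} {b} {b′} {d} x+d y+d = suc-injective (suc-injective (begin
  suc (suc (a′ + b))   ≡⟨ cong suc (+-suc a′ b) ⟨
  suc a′ + suc b       ≡⟨ ℤ.+-injective (begin
    + suc a′ ℤ.+ + suc b          ≡⟨ cong (ℤ._+ + suc b) x+d ⟨
    + suc a ℤ.+ d ℤ.+ + suc b     ≡⟨ ℤ.+-assoc (+ suc a) d (+ suc b) ⟩
    + suc a ℤ.+ (d ℤ.+ + suc b)   ≡⟨ cong (λ t → + suc a ℤ.+ t) (trans (ℤ.+-comm d (+ suc b)) y+d) ⟩
    + suc a ℤ.+ + suc b′          ∎) ⟩
  suc a + suc b′       ≡⟨ cong suc (+-suc a b′) ⟩
  suc (suc (a + b′))   ∎))
  where open ≡-Reasoning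

Digits : ℕ → ∀ {k} → Vec ℕ k → Set
Digits q = VecAll.All (_< q)

Digits-≤ : ∀ {q q′ k} {xs : Vec ℕ k} → q ≤ q′ → Digits q xs → Digits q′ xs
Digits-≤ q≤q′ = VecAll.map (λ a<q → <-≤-trans a<q q≤q′)

Digits-+ : ∀ {h k} {xs ys : Vec ℕ k} → Digits h xs → Digits h ys → Digits (2 * h) (zipWith _+_ xs ys)
Digits-+ {h} = VecAll.zipWith (λ a<h b<h → +-mono-< a<h (<-≤-trans b<h (m≤m+n h 0)))

fromDigits : ℕ → ∀ {k} → Vec ℕ k → ℕ
fromDigits q []       = 0
fromDigits q (a ∷ as) = a + fromDigits q as * q

fromDigits-+ : ∀ q {k} (xs ys : Vec ℕ k) →
               fromDigits q (zipWith _+_ xs ys) ≡ fromDigits q xs + fromDigits q ys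
fromDigits-+ q []       []       = refl
fromDigits-+ q (a ∷ xs) (b ∷ ys) = begin
  a + b + fromDigits q (zipWith _+_ xs ys) * q ≡⟨ cong (λ s → a + b + s * q) (fromDigits-+ q xs ys) ⟩
  a + b + (x + y) * q                         ≡⟨ cong (λ t → a + b + t) (*-distribʳ-+ q x y) ⟩
  a + b + (x * q + y * q)                     ≡⟨ +-interchange a b (x * q) (y * q) ⟩
  a + x * q + (b + y * q)                     ∎
  where
  open ≡-Reasoning
  x = fromDigits q xs
  y = fromDigits q ys

fromDigits-injective : ∀ {q k} {xs ys : Vec ℕ k} → Digits q xs → Digits q ys →
                       fromDigits q xs ≡ fromDigits q ys → xs ≡ ys
fromDigits-injective [] [] _ = refl
fromDigits-injective (a<q ∷ as) (b<q ∷ bs) eq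
  with refl , rest ← remainder-quotient-unique a<q b<q eq
  = cong (_ ∷_) (fromDigits-injective as bs rest)

fromDigits-< : ∀ {q k} {xs : Vec ℕ k} → Digits q xs → fromDigits q xs < q ^ k
fromDigits-< [] = s≤s z≤n
fromDigits-< {q} {suc k} {a ∷ xs} (a<q ∷ as) = begin-strict
  a + fromDigits q xs * q   <⟨ +-monoˡ-< _ a<q ⟩
  suc (fromDigits q xs) * q ≤⟨ *-monoˡ-≤ q (fromDigits-< as) ⟩
  q ^ k * q                 ≡⟨ *-comm (q ^ k) q ⟩
  q ^ suc k                 ∎
  where open ≤-Reasoning

⟨_,_⟩ : ∀ {k} → Vec ℕ k → Vec ℕ k → ℕ
⟨ xs , ys ⟩ = sum (zipWith _*_ xs ys)

‖_‖² : ∀ {k} → Vec ℕ k → ℕ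
‖ xs ‖² = ⟨ xs , xs ⟩

dist² : ∀ {k} → Vec ℕ k → Vec ℕ k → ℕ
dist² xs ys = ‖ zipWith ∣_-_∣ xs ys ‖²

‖‖²-shift : ∀ {k} (xs′ xs ys zs : Vec ℕ k) → zipWith _+_ xs′ ys ≡ zipWith _+_ xs zs →
            ‖ xs′ ‖² + 2 * ⟨ xs , ys ⟩ ≡ ‖ xs ‖² + 2 * ⟨ xs , zs ⟩ + dist² ys zs
‖‖²-shift [] [] [] [] _ = refl
‖‖²-shift (a′ ∷ xs′) (a ∷ xs) (b ∷ ys) (c ∷ zs) eq
  with heads , tails ← ∷-injective eq = begin
  a′ * a′ + ‖ xs′ ‖² + 2 * (a * b + ⟨ xs , ys ⟩)
    ≡⟨ regroup (a′ * a′) _ (a * b) _ ⟩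
  (a′ * a′ + 2 * (a * b)) + (‖ xs′ ‖² + 2 * ⟨ xs , ys ⟩)
    ≡⟨ cong₂ _+_ (square-shift {a′} {a} {b} {c} heads) (‖‖²-shift xs′ xs ys zs tails) ⟩
  (a * a + 2 * (a * c) + ∣ b - c ∣ * ∣ b - c ∣) + (‖ xs ‖² + 2 * ⟨ xs , zs ⟩ + dist² ys zs)
    ≡⟨ regroup₃ (a * a) _ (a * c) _ (∣ b - c ∣ * ∣ b - c ∣) _ ⟨
  a * a + ‖ xs ‖² + 2 * (a * c + ⟨ xs , zs ⟩) + (∣ b - c ∣ * ∣ b - c ∣ + dist² ys zs) ∎
  where
  open ≡-Reasoning
  regroup : ∀ p s i j → p + s + 2 * (i + j) ≡ (p + 2 * i) + (s + 2 * j)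
  regroup = solve-∀
  regroup₃ : ∀ p s i j t u → p + s + 2 * (i + j) + (t + u) ≡ (p + 2 * i + t) + (s + 2 * j + u)
  regroup₃ = solve-∀

dist²≡0⇒≡ : ∀ {k} (ys zs : Vec ℕ k) → dist² ys zs ≡ 0 → ys ≡ zs
dist²≡0⇒≡ [] [] _ = refl
dist²≡0⇒≡ (b ∷ ys) (c ∷ zs) eq = cong₂ _∷_
  (∣m-n∣≡0⇒m≡n (reduce (m*n≡0⇒m≡0∨n≡0 ∣ b - c ∣ (m+n≡0⇒m≡0 _ eq))))
  (dist²≡0⇒≡ ys zs (m+n≡0⇒n≡0 _ eq))

levelSet-rigid : ∀ {k} (xs′ xs ys zs : Vec ℕ k) → zipWith _+_ xs′ ys ≡ zipWith _+_ xs zs →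
                 ‖ xs′ ‖² ≡ ‖ xs ‖² → ⟨ xs , ys ⟩ ≡ ⟨ xs , zs ⟩ → ys ≡ zs
levelSet-rigid xs′ xs ys zs sums norms products =
  dist²≡0⇒≡ ys zs (sym (+-cancelˡ-≡ (‖ xs ‖² + 2 * ⟨ xs , zs ⟩) 0 _ (begin
    ‖ xs ‖² + 2 * ⟨ xs , zs ⟩ + 0           ≡⟨ +-identityʳ _ ⟩
    ‖ xs ‖² + 2 * ⟨ xs , zs ⟩               ≡⟨ cong₂ (λ s p → s + 2 * p) norms products ⟨
    ‖ xs′ ‖² + 2 * ⟨ xs , ys ⟩              ≡⟨ ‖‖²-shift xs′ xs ys zs sums ⟩
    ‖ xs ‖² + 2 * ⟨ xs , zs ⟩ + dist² ys zs ∎)))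
  where open ≡-Reasoning

⟨⟩-≤ : ∀ {h k} {xs ys : Vec ℕ k} → Digits h xs → Digits h ys → ⟨ xs , ys ⟩ ≤ k * (h * h)
⟨⟩-≤ [] [] = z≤n
⟨⟩-≤ (a<h ∷ as) (b<h ∷ bs) = +-mono-≤ (*-mono-≤ (<⇒≤ a<h) (<⇒≤ b<h)) (⟨⟩-≤ as bs)

length-filter-+-∁ : ∀ {A : Set} {P : Pred A 0ℓ} (P? : Decidable P) xs →
                    length (filter P? xs) + length (filter (∁? P?) xs) ≡ length xs
length-filter-+-∁ P? List.[] = refl
length-filter-+-∁ P? (x List.∷ xs) with does (P? x)
... | true  = cong suc (length-filter-+-∁ P? xs)
... | false = trans (+-suc _ _) (cong suc (length-filter-+-∁ P? xs))

length-cartesianProductWith : ∀ {A B C : Set} (f : A → B → C) xs ys →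
                              length (cartesianProductWith f xs ys) ≡ length xs * length ys
length-cartesianProductWith f List.[]        ys = refl
length-cartesianProductWith f (x List.∷ xs) ys = trans (length-++ (List.map (f x) ys))
  (cong₂ _+_ (length-map (f x) ys) (length-cartesianProductWith f xs ys))

module _ {B : Set} (f : B → ℕ) where

  fibre : ℕ → List B → List B
  fibre v = filter (λ x → f x ≟ v)

  ∈-fibre⁻ : ∀ {v x xs} → x ∈ fibre v xs → f x ≡ v
  ∈-fibre⁻ {v} {xs = xs} x∈ = proj₂ (∈-filter⁻ (λ x → f x ≟ v) {xs = xs} x∈)

  private
    rest : ℕ → List B → List B
    rest R = filter (∁? (λ x → f x ≟ R))

    rest-bounded : ∀ R xs → All (λ x → f x < suc R) xs → All (λ x → f x < R) (rest R xs)
    rest-bounded R xs fxs≤R = All.zipWith (λ (fx≤R , fx≢R) → ≤∧≢⇒< (s≤s⁻¹ fx≤R) fx≢R)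
      (All.filter⁺ _ fxs≤R , All.all-filter _ xs)

    fibre-rest : ∀ R v xs → length (fibre v (rest R xs)) ≤ length (fibre v xs)
    fibre-rest R v xs = length-mono-≤ (filter⁺ _ _ (λ where refl p → p) (filter-⊆ _ xs))

    ≤-suc-*-⊔ : ∀ {n a r b} R → n ≡ a + r → r ≤ R * b → n ≤ suc R * (a ⊔ b)
    ≤-suc-*-⊔ {a = a} {b = b} R refl r≤Rb =
      +-mono-≤ (m≤m⊔n a b) (≤-trans r≤Rb (*-monoʳ-≤ R (m≤n⊔m a b)))

  -- Split off the class R: either its fibre or the inductive fibre among the rest is large enough.
  pigeonhole : ∀ R xs → All (λ x → f x < R) xs → ∃[ v ] length xs ≤ R * length (fibre v xs)
  pigeonhole zero List.[] All.[] = 0 , z≤n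
  pigeonhole (suc R) xs fxs≤R
    with v , rest≤ ← pigeonhole R (rest R xs) (rest-bounded R xs fxs≤R)
    with bound ← ≤-suc-*-⊔ R (sym (length-filter-+-∁ _ xs)) rest≤
    with ⊔-sel (length (fibre R xs)) (length (fibre v (rest R xs)))
  ... | inj₁ ⊔≡a = R , subst (λ c → length xs ≤ suc R * c) ⊔≡a bound
  ... | inj₂ ⊔≡b = v , (begin
    length xs                            ≤⟨ subst (λ c → length xs ≤ suc R * c) ⊔≡b bound ⟩
    suc R * length (fibre v (rest R xs)) ≤⟨ *-monoʳ-≤ (suc R) (fibre-rest R v xs) ⟩
    suc R * length (fibre v xs)          ∎)
    where open ≤-Reasoning

box : ∀ h k → List (Vec (Fin h) k)
box h zero    = [ [] ]
box h (suc k) = cartesianProductWith _∷_ (allFin h) (box h k)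

length-box : ∀ h k → length (box h k) ≡ h ^ k
length-box h zero    = refl
length-box h (suc k) = trans (length-cartesianProductWith _∷_ (allFin h) (box h k))
  (cong₂ _*_ (length-tabulate {n = h} (λ i → i)) (length-box h k))

box-unique : ∀ h k → Unique (box h k)
box-unique h zero    = All.[] ∷ []
box-unique h (suc k) = Unique.cartesianProductWith⁺ _∷_ ∷-injective (Unique.allFin⁺ h) (box-unique h k)

digits : ∀ {h k} → Vec (Fin h) k → Vec ℕ k
digits = Vec.map toℕ

digits-< : ∀ {h k} (X : Vec (Fin h) k) → Digits h (digits X)
digits-< X = VecAll.map⁺ (VecAll.universal toℕ<n X)

digits-injective : ∀ {h k} {X Y : Vec (Fin h) k} → digits X ≡ digits Y → X ≡ Y
digits-injective {X = []}    {[]}    _  = refl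
digits-injective {X = a ∷ X} {b ∷ Y} eq with a≡b , X≡Y ← ∷-injective eq =
  cong₂ _∷_ (toℕ-injective a≡b) (digits-injective X≡Y)

module LevelSets (h k : ℕ) where

  Pair : Set
  Pair = Vec (Fin h) k × Vec (Fin h) k

  -- Base 2h rather than h: digitwise sums of two vectors are still digits.
  encode : Vec (Fin h) k → ℕ
  encode X = fromDigits (2 * h) (digits X)

  encode-injective : ∀ {X Y} → encode X ≡ encode Y → X ≡ Y
  encode-injective {X} {Y} =
    digits-injective ∘ fromDigits-injective (Digits-≤ (m≤m+n h _) (digits-< X)) (Digits-≤ (m≤m+n h _) (digits-< Y))

  encode-< : ∀ X → encode X < (2 * h) ^ k
  encode-< X = fromDigits-< (Digits-≤ (m≤m+n h _) (digits-< X))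

  embed : Pair → ℤ × ℤ
  embed (X , Y) = + suc (encode X) , + suc (encode Y)

  embed-injective : ∀ {p q} → embed p ≡ embed q → p ≡ q
  embed-injective e = cong₂ _,_ (encode-injective (suc-injective (ℤ.+-injective (cong proj₁ e))))
                                (encode-injective (suc-injective (ℤ.+-injective (cong proj₂ e))))

  embed-inGrid : ∀ {n} → (2 * h) ^ k ≤ n → ∀ p → InGrid n (embed p)
  embed-inGrid fits (X , Y) = (ℤ.+≤+ (s≤s z≤n) , ℤ.+≤+ (≤-trans (encode-< X) fits))
                            , (ℤ.+≤+ (s≤s z≤n) , ℤ.+≤+ (≤-trans (encode-< Y) fits))

  shape : Pair → ℕ × ℕ
  shape (X , Y) = ‖ digits X ‖² , ⟨ digits X , digits Y ⟩

  skew-corner-collapse : ∀ {X′ Y′ X Y Z} → shape (X′ , Y′) ≡ shape (X , Y) → shape (X , Y) ≡ shape (X , Z) →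
                         encode X′ + encode Y ≡ encode X + encode Z → Y ≡ Z
  skew-corner-collapse {X′} {Y′} {X} {Y} {Z} s₁ s₂ eq = digits-injective
    (levelSet-rigid (digits X′) (digits X) (digits Y) (digits Z) sums (cong proj₁ s₁) (cong proj₂ s₂))
    where
    sums : zipWith _+_ (digits X′) (digits Y) ≡ zipWith _+_ (digits X) (digits Z)
    sums = fromDigits-injective (Digits-+ (digits-< X′) (digits-< Y)) (Digits-+ (digits-< X) (digits-< Z))
      (trans (fromDigits-+ _ (digits X′) (digits Y)) (trans eq (sym (fromDigits-+ _ (digits X) (digits Z)))))

  embed-skewCornerFree : (P : List Pair) → (∀ {p q} → p ∈ P → q ∈ P → shape p ≡ shape q) →
                         SkewCornerFree (List.map embed P)
  embed-skewCornerFree P same-shape x y y′ d d≢0 c₁ c₂ c₃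
    with (X , Y) , p₁ , refl ← ∈-map⁻ embed c₁
       | (X₂ , Z) , p₂ , e₂ ← ∈-map⁻ embed c₂
       | (X′ , Y′) , p₃ , e₃ ← ∈-map⁻ embed c₃
    with refl ← encode-injective {X} {X₂} (suc-injective (ℤ.+-injective (cong proj₁ e₂)))
    = d≢0 (identityʳ-unique y d (trans (cong proj₂ e₂) (cong (λ W → + suc (encode W)) (sym Y≡Z))))
    where
    Y≡Z : Y ≡ Z
    Y≡Z = skew-corner-collapse {X′} {Y′} {X} {Y} {Z} (same-shape p₃ p₁) (same-shape p₁ p₂)
            (skew-corner-sum {d = d} (cong proj₁ e₃) (cong proj₂ e₂))

  M : ℕ
  M = suc (k * (h * h))

  -- An injective encoding of the shape into [0, M²), since ⟨X, Y⟩ < M.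
  code : Pair → ℕ
  code (X , Y) = ⟨ digits X , digits Y ⟩ + ‖ digits X ‖² * M

  ⟨⟩<M : ∀ X Y → ⟨ digits X , digits Y ⟩ < M
  ⟨⟩<M X Y = s≤s (⟨⟩-≤ {h} {k} (digits-< X) (digits-< Y))

  code-< : ∀ p → code p < M * M
  code-< (X , Y) = begin-strict
    ⟨ digits X , digits Y ⟩ + ‖ digits X ‖² * M  <⟨ +-monoˡ-< _ (⟨⟩<M X Y) ⟩
    suc ‖ digits X ‖² * M                          ≤⟨ *-monoˡ-≤ M (⟨⟩<M X X) ⟩
    M * M                                          ∎
    where open ≤-Reasoning

  code-injective : ∀ p q → code p ≡ code q → shape p ≡ shape q
  code-injective (X , Y) (X′ , Y′) eq =
    let ⟨⟩≡ , ‖‖²≡ = remainder-quotient-unique (⟨⟩<M X Y) (⟨⟩<M X′ Y′) eq in cong₂ _,_ ‖‖²≡ ⟨⟩≡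

  pairs : List Pair
  pairs = cartesianProduct (box h k) (box h k)

  fibre-shape : ∀ {v p q} → p ∈ fibre code v pairs → q ∈ fibre code v pairs → shape p ≡ shape q
  fibre-shape {v} {p} {q} p∈ q∈ =
    code-injective p q (trans (∈-fibre⁻ code {v} {xs = pairs} p∈) (sym (∈-fibre⁻ code {v} {xs = pairs} q∈)))

  dense-fibre : ∃[ v ] h ^ k * h ^ k ≤ M * M * length (fibre code v pairs)
  dense-fibre with v , bound ← pigeonhole code (M * M) pairs (All.universal code-< pairs) =
    v , subst (_≤ M * M * length (fibre code v pairs)) length-pairs bound
    where
    length-pairs : length pairs ≡ h ^ k * h ^ k
    length-pairs = trans (length-cartesianProductWith _,_ (box h k) (box h k))
                         (cong₂ _*_ (length-box h k) (length-box h k))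

  fibre-skewCornerFree : ∀ {n} → (2 * h) ^ k ≤ n → ∀ v →
                         SkewCornerFreeSubsetOfSize n (length (fibre code v pairs))
  fibre-skewCornerFree {n} fits v = List.map embed P , unique , in-grid , scf , length-map embed P
    where
    P = fibre code v pairs
    unique : Unique (List.map embed P)
    unique = Unique.map⁺ embed-injective
      (Unique.filter⁺ (λ p → code p ≟ v) (Unique.cartesianProduct⁺ (box-unique h k) (box-unique h k)))
    in-grid : All (InGrid n) (List.map embed P)
    in-grid = All.map⁺ (All.universal (embed-inGrid fits) P)
    scf : SkewCornerFree (List.map embed P)
    scf = embed-skewCornerFree P fibre-shape

  skewCornerFree-subset : ∀ {n} → (2 * h) ^ k ≤ n →
                          ∃[ m ] SkewCornerFreeSubsetOfSize n m × h ^ k * h ^ k ≤ M * M * m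
  skewCornerFree-subset fits = let v , dense = dense-fibre in _ , fibre-skewCornerFree fits v , dense

-- log₂(n² / m) ≤ cK ≤ c √log₂ n ≤ (k / l) √log₂ n.
boundHolds : ∀ {c k l n m K} → 2 ^ (K * K) ≤ n → n * n ≤ m * 2 ^ (c * K) → c * l ≤ k → BoundHolds k l n m
boundHolds {c} {k} {l} {n} {m} {K} 2^K²≤n n²≤m2^cK cl≤k a b _ 2^a*m^b<n^2b = begin
  2 ^ (a * a * (l * l))             ≤⟨ ^-monoʳ-≤ 2 exponent ⟩
  2 ^ (K * K * (k * k * (b * b)))   ≡⟨ ^-*-assoc 2 (K * K) _ ⟨
  (2 ^ (K * K)) ^ (k * k * (b * b)) ≤⟨ ^-monoˡ-≤ (k * k * (b * b)) 2^K²≤n ⟩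
  n ^ (k * k * (b * b))             ∎
  where
  open ≤-Reasoning
  2^a*m^b<2^cKb*m^b : 2 ^ a * m ^ b < 2 ^ (c * K * b) * m ^ b
  2^a*m^b<2^cKb*m^b = begin-strict
    2 ^ a * m ^ b             <⟨ 2^a*m^b<n^2b ⟩
    n ^ (2 * b)               ≡⟨ ^-*-assoc n 2 b ⟨
    (n * (n * 1)) ^ b         ≡⟨ cong (λ t → (n * t) ^ b) (*-identityʳ n) ⟩
    (n * n) ^ b               ≤⟨ ^-monoˡ-≤ b n²≤m2^cK ⟩
    (m * 2 ^ (c * K)) ^ b     ≡⟨ ^-distribʳ-* m _ b ⟩
    m ^ b * (2 ^ (c * K)) ^ b ≡⟨ cong (m ^ b *_) (^-*-assoc 2 (c * K) b) ⟩
    m ^ b * 2 ^ (c * K * b)   ≡⟨ *-comm (m ^ b) _ ⟩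
    2 ^ (c * K * b) * m ^ b   ∎
  a≤cKb : a ≤ c * K * b
  a≤cKb = ≮⇒≥ λ cKb<a → <-asym (*-cancelʳ-< (m ^ b) _ _ 2^a*m^b<2^cKb*m^b) (^-monoʳ-< 2 (s≤s (s≤s z≤n)) cKb<a)
  al≤Kkb : a * l ≤ K * (k * b)
  al≤Kkb = begin
    a * l           ≤⟨ *-monoˡ-≤ l a≤cKb ⟩
    c * K * b * l   ≡⟨ regroup c K b l ⟩
    K * (c * l * b) ≤⟨ *-monoʳ-≤ K (*-monoˡ-≤ b cl≤k) ⟩
    K * (k * b)     ∎
    where
    regroup : ∀ c K b l → c * K * b * l ≡ K * (c * l * b)
    regroup = solve-∀
  exponent : a * a * (l * l) ≤ K * K * (k * k * (b * b))
  exponent = begin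
    a * a * (l * l)             ≡⟨ *-interchange a a l l ⟩
    a * l * (a * l)             ≤⟨ *-mono-≤ al≤Kkb al≤Kkb ⟩
    K * (k * b) * (K * (k * b)) ≡⟨ *-interchange K (k * b) K (k * b) ⟩
    K * K * (k * b * (k * b))   ≡⟨ cong (K * K *_) (*-interchange k b k b) ⟩
    K * K * (k * k * (b * b))   ∎

dyadic-skewCornerFree : ∀ j {n} → 2 ^ (suc j * suc j) ≤ n → n < 2 ^ (suc (suc j) * suc (suc j)) →
                        ∃[ m ] SkewCornerFreeSubsetOfSize n m × n * n ≤ m * 2 ^ (12 * suc j)
dyadic-skewCornerFree j {n} 2^K²≤n n<2^T =
  let m , subset , dense = skewCornerFree-subset fits in
  m , subset , *-cancelʳ-≤ (n * n) (m * 2 ^ (12 * K)) (2 ^ E) {{m^n≢0 2 E}} (rescaled dense)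
  where
  K T S E : ℕ
  K = suc j
  T = suc K * suc K
  S = K + (j + j)
  E = j * K + j * K
  h = 2 ^ j
  open LevelSets h K using (M; skewCornerFree-subset)
  open ≤-Reasoning

  fits : (2 * h) ^ K ≤ n
  fits = subst (_≤ n) (sym (^-*-assoc 2 K K)) 2^K²≤n

  h^K*h^K≡2^E : h ^ K * h ^ K ≡ 2 ^ E
  h^K*h^K≡2^E = trans (cong₂ _*_ (^-*-assoc 2 j K) (^-*-assoc 2 j K)) (sym (^-distribˡ-+-* 2 (j * K) (j * K)))

  n²M²≤ : n * n * (M * M) ≤ 2 ^ (T + T + (S + S))
  n²M²≤ = *-mono-≤-2^ (T + T) (S + S) (*-mono-≤-2^ T T (<⇒≤ n<2^T) (<⇒≤ n<2^T)) (*-mono-≤-2^ S S M≤2^S M≤2^S)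
    where M≤2^S = 1+k[2^j]²≤2^[k+2j] K j

  exponent : T + T + (S + S) ≤ 12 * K + E
  exponent = subst (T + T + (S + S) ≤_) (excess j) (m≤m+n (T + T + (S + S)) 2)
    where
    excess : ∀ j → suc (suc j) * suc (suc j) + suc (suc j) * suc (suc j) + ((suc j + (j + j)) + (suc j + (j + j))) + 2
                   ≡ 12 * suc j + (j * suc j + j * suc j)
    excess = solve-∀

  rescaled : ∀ {m} → h ^ K * h ^ K ≤ M * M * m → n * n * 2 ^ E ≤ m * 2 ^ (12 * K) * 2 ^ E
  rescaled {m} dense = begin
    n * n * 2 ^ E                ≤⟨ *-monoʳ-≤ (n * n) (subst (_≤ M * M * m) h^K*h^K≡2^E dense) ⟩
    n * n * (M * M * m)          ≡⟨ *-assoc (n * n) (M * M) m ⟨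
    n * n * (M * M) * m          ≤⟨ *-monoˡ-≤ m n²M²≤ ⟩
    2 ^ (T + T + (S + S)) * m    ≤⟨ *-monoˡ-≤ m (^-monoʳ-≤ 2 exponent) ⟩
    2 ^ (12 * K + E) * m         ≡⟨ cong (_* m) (^-distribˡ-+-* 2 (12 * K) E) ⟩
    2 ^ (12 * K) * 2 ^ E * m     ≡⟨ *-comm _ m ⟩
    m * (2 ^ (12 * K) * 2 ^ E)   ≡⟨ *-assoc m _ _ ⟨
    m * 2 ^ (12 * K) * 2 ^ E     ∎

sLowerBound-12 : ∀ {k l} → 12 * l ≤ k → ∀ n → 2 ≤ n → sLowerBound k l n
sLowerBound-12 {k} {l} 12l≤k n 2≤n with bracket (λ i → 2 ^ (i * i)) 2^i²<2^[1+i]² (≤-trans (s≤s z≤n) 2≤n)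
... | zero  , _ , n<2 = contradiction 2≤n (<⇒≱ n<2)
... | suc j , 2^K²≤n , n<2^[K+1]² =
  let m , subset , n²≤m2^12K = dyadic-skewCornerFree j 2^K²≤n n<2^[K+1]² in
  m , subset , boundHolds {c = 12} {k} {l} {K = suc j} 2^K²≤n n²≤m2^12K 12l≤k

theorem1 : Σ ℕ λ k → Σ ℕ λ l → (1 ≤ k) × (1 ≤ l) × ((e f : ℕ) → 1 ≤ e → 1 ≤ f → Σ ℕ λ N → (n : ℕ) → N ≤ n → sLowerBound (k * f + e * l) (l * f) n)
theorem1 = 12 , 1 , s≤s z≤n , s≤s z≤n , λ e f _ _ → 2 , sLowerBound-12 {12 * f + e * 1} {1 * f} (12l≤k e f)
  where
  12l≤k : ∀ e f → 12 * (1 * f) ≤ 12 * f + e * 1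
  12l≤k e f = ≤-trans (≤-reflexive (cong (12 *_) (*-identityˡ f))) (m≤m+n (12 * f) (e * 1))
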